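{- Let $p,q$ be distinct primes greater than $5$, let $\mathbb{Z}_{pq} = \langle x_p\rangle\times\langle x_q\rangle$ with $|x_p|=p$, $|x_q|=q$, and let $G = (\mathbb{Z}_2)^3 \ltimes \mathbb{Z}_{pq}$. Suppose $S = \{a, b, c, ab\,x_p x_q\}$, where $\langle a,b,c\rangle = (\mathbb{Z}_2)^3$, such that $a$ inverts $\langle x_p\rangle$ and centralizes $\langle x_q\rangle$, and $b$ and $c$ centralize $\langle x_p\rangle$ and invert $\langle x_q\rangle$. Then $\mathrm{Cay}(G;S)$ has a hamiltonian cycle.
   Context: $\mathrm{Cay}(G;S)$ is the graph with vertex set $G$ in which $g,h$ are adjacent iff $h = gs$ for some $s\in S\cup S^{ -1}$. An element inverts a subgroup if conjugation by it sends each element of the subgroup to its inverse. -}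

module Defs where

open import Data.Bool using (Bool; true; false; _xor_; if_then_else_)
open import Data.Nat using (ℕ; suc; _+_; _∸_; _≤_; NonZero)
open import Data.Nat.DivMod using (_mod_)
open import Data.Fin using (Fin; toℕ)
open import Data.List using (List; []; _∷_; _++_; length)
open import Data.List.Relation.Unary.Linked using (Linked)
open import Data.List.Relation.Unary.Unique.Propositional using (Unique)
open import Data.List.Membership.Propositional using (_∈_)
open import Data.Product using (∃-syntax; _×_)
open import Data.Sum using (_⊎_)
open import Relation.Binary.PropositionalEquality using (_≡_)

module _ (n : ℕ) .{{_ : NonZero n}} where
  zeroₘ : Fin n
  zeroₘ = 0 mod n

  oneₘ : Fin n
  oneₘ = 1 mod n

  addₘ : Fin n → Fin n → Fin n
  addₘ i j = (toℕ i + toℕ j) mod n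

  negₘ : Fin n → Fin n
  negₘ i = (n ∸ toℕ i) mod n

-- Elements a^α b^β c^γ x_p^i x_q^j of G = (ℤ₂)³ ⋉ (⟨x_p⟩ × ⟨x_q⟩).
record Elt (p q : ℕ) : Set where
  constructor elt
  field
    α β γ : Bool
    i : Fin p
    j : Fin q

-- Multiplication: conjugating by a^α b^β c^γ sends x_p ↦ x_p^{(-1)^α}
-- (a inverts ⟨x_p⟩, b,c centralize it) and x_q ↦ x_q^{(-1)^{β+γ}}
-- (a centralizes ⟨x_q⟩, b,c invert it).
-- (v x)(w y) = (v w)(w⁻¹ x w) y.
module _ (p q : ℕ) .{{_ : NonZero p}} .{{_ : NonZero q}} where
  infixl 7 _·_
  _·_ : Elt p q → Elt p q → Elt p q
  elt α β γ i j · elt α' β' γ' i' j' =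
    elt (α xor α') (β xor β') (γ xor γ')
        (addₘ p (if α' then negₘ p i else i) i')
        (addₘ q (if (β' xor γ') then negₘ q j else j) j')

  a b c s₄ : Elt p q
  a = elt true false false (zeroₘ p) (zeroₘ q)
  b = elt false true false (zeroₘ p) (zeroₘ q)
  c = elt false false true (zeroₘ p) (zeroₘ q)
  s₄ = elt true true false (oneₘ p) (oneₘ q)

  S : List (Elt p q)
  S = a ∷ b ∷ c ∷ s₄ ∷ []

-- Cayley graph adjacency for a connection set S: h = g s with s ∈ S ∪ S⁻¹
-- (h = g s⁻¹ iff g = h s).
CayAdj : {G : Set} → (G → G → G) → List G → G → G → Set
CayAdj _∙_ S g h = ∃[ s ] (s ∈ S × (h ≡ g ∙ s ⊎ g ≡ h ∙ s))

record HamiltonianCycle {V : Set} (Adj : V → V → Set) : Set where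
  field
    start : V
    rest  : List V
    distinct : Unique (start ∷ rest)
    covers   : ∀ v → v ∈ (start ∷ rest)
    long     : 3 ≤ length (start ∷ rest)
    adjacent : Linked Adj (start ∷ rest ++ start ∷ [])

CayleyHamiltonian : (p q : ℕ) .{{_ : NonZero p}} .{{_ : NonZero q}} → Set
CayleyHamiltonian p q = HamiltonianCycle (CayAdj (_·_ p q) (S p q))

module Submission where

-- The cycle is the generator word
-- ((s₄ a)^(p-1) s₄ b (s₄ a)^(p-1) s₄ c)^(2q), of length 8pq = |G|.  Within a
-- row (s₄ a)^(p-1) s₄ the x_p-exponent runs through 0, 1, -1, 2, -2, ..., hence
-- through every residue mod p, while the x_q-exponent alternates between -r
-- and r + 1 for the row index r; the closing b or c moves to row r + 1.
-- A vertex of row r < 4q is recovered from its coordinates: its place in the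
-- row from the x_p-exponent and the parity of the number of s₄'s (p odd),
-- r mod q from the x_q-exponent, and r mod 4 from the a- and c-components,
-- which determine r because q is odd.  So the 8pq vertices are distinct,
-- hence exhaust G.

open import Defs
open import Data.Bool using (Bool; true; false; not; _xor_; _∧_)
open import Data.Bool.Properties
  using (not-involutive; not-injective; not-¬; not-distribˡ-xor; not-distribʳ-xor; xor-same;
         xor-identityʳ; xor-comm; xor-inverseˡ; xor-annihilates-not)
open import Data.Nat
open import Data.Nat.Properties
open import Data.Nat.DivMod
open import Data.Nat.Divisibility using (_∣_; divides; m%n≡0⇒n∣m; ∣-refl; ∣m∣n⇒∣m+n)
open import Data.Nat.Primality using (Prime; composite; prime⇒¬composite)
open import Data.Nat.Tactic.RingSolver using (solve-∀)
open import Data.Fin using (Fin; toℕ; zero; suc)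
open import Data.Fin.Properties
  using (toℕ<n; toℕ-injective; toℕ-fromℕ<; any?; injective⇒≤; 2↔Bool; *↔×)
  renaming (_≟_ to _≟ᶠ_)
open import Data.List using (applyUpTo; _∷_; _∷ʳ_)
open import Data.List.Properties using (length-applyUpTo; applyUpTo-∷ʳ)
open import Data.List.Membership.Propositional using (_∈_)
open import Data.List.Relation.Unary.Any using (here; there)
open import Data.List.Relation.Unary.Linked using (Linked)
import Data.List.Relation.Unary.Any.Properties as Any
import Data.List.Relation.Unary.Linked.Properties as Linked
import Data.List.Relation.Unary.Unique.Propositional.Properties as Unique
open import Data.Product using (_×_; _,_; proj₁; proj₂; ∃-syntax)
open import Data.Product.Function.NonDependent.Propositional using (_×-↔_)
open import Data.Sum using (inj₁; inj₂)
open import Function.Base using (_∘_)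
open import Function.Bundles using (_↔_; _↣_; Injection; mk↔ₛ′)
open import Function.Properties.Inverse using (↔-trans; ↔-sym; ↔⇒↣)
open import Relation.Binary.PropositionalEquality
open import Relation.Nullary using (contradiction; yes; no)
open ≡-Reasoning

odd : ℕ → Bool
odd zero    = false
odd (suc n) = not (odd n)

odd-+ : ∀ m n → odd (m + n) ≡ odd m xor odd n
odd-+ zero    n = refl
odd-+ (suc m) n = trans (cong not (odd-+ m n)) (not-distribˡ-xor (odd m) (odd n))

odd-* : ∀ m n → odd (m * n) ≡ odd m ∧ odd n
odd-* zero    n = refl
odd-* (suc m) n = begin
  odd (n + m * n)             ≡⟨ odd-+ n (m * n) ⟩
  odd n xor odd (m * n)       ≡⟨ cong (odd n xor_) (odd-* m n) ⟩
  odd n xor (odd m ∧ odd n)   ≡⟨ xor-∧ (odd m) (odd n) ⟩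
  not (odd m) ∧ odd n         ∎
  where
  xor-∧ : ∀ x y → y xor (x ∧ y) ≡ not x ∧ y
  xor-∧ false y = xor-identityʳ y
  xor-∧ true  y = xor-same y

odd-2* : ∀ n → odd (2 * n) ≡ false
odd-2* n = odd-* 2 n

odd-⌊1+n/2⌋ : ∀ n → odd ⌊ suc n /2⌋ ≡ odd n xor odd ⌊ n /2⌋
odd-⌊1+n/2⌋ zero          = refl
odd-⌊1+n/2⌋ (suc zero)    = refl
odd-⌊1+n/2⌋ (suc (suc n)) = begin
  not (odd ⌊ suc n /2⌋)             ≡⟨ cong not (odd-⌊1+n/2⌋ n) ⟩
  not (odd n xor odd ⌊ n /2⌋)       ≡⟨ not-distribʳ-xor (odd n) _ ⟩
  odd n xor not (odd ⌊ n /2⌋)       ≡⟨ cong (_xor not (odd ⌊ n /2⌋)) (not-involutive (odd n)) ⟨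
  not (not (odd n)) xor not (odd ⌊ n /2⌋) ∎

⌊m+2n/2⌋≡⌊m/2⌋+n : ∀ m n → ⌊ m + 2 * n /2⌋ ≡ ⌊ m /2⌋ + n
⌊m+2n/2⌋≡⌊m/2⌋+n m zero    = trans (cong ⌊_/2⌋ (+-identityʳ m)) (sym (+-identityʳ _))
⌊m+2n/2⌋≡⌊m/2⌋+n m (suc n) = begin
  ⌊ m + 2 * suc n /2⌋       ≡⟨ cong ⌊_/2⌋ (m+2[1+n]≡2+m+2n m n) ⟩
  suc ⌊ m + 2 * n /2⌋       ≡⟨ cong suc (⌊m+2n/2⌋≡⌊m/2⌋+n m n) ⟩
  suc (⌊ m /2⌋ + n)         ≡⟨ +-suc ⌊ m /2⌋ n ⟨
  ⌊ m /2⌋ + suc n           ∎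
  where
  m+2[1+n]≡2+m+2n : ∀ m n → m + 2 * suc n ≡ suc (suc (m + 2 * n))
  m+2[1+n]≡2+m+2n = solve-∀

odd-+-odd : ∀ m {n} → odd n ≡ true → odd (m + n) ≡ not (odd m)
odd-+-odd m {n} n-odd = trans (odd-+ m n) (trans (cong (odd m xor_) n-odd) (xor-comm (odd m) true))

%≡%⇒∣∸ : ∀ d .{{_ : NonZero d}} {a b} → a % d ≡ b % d → d ∣ b ∸ a
%≡%⇒∣∸ d {a} {b} eq = divides (b / d ∸ a / d) (begin
  b ∸ a                                    ≡⟨ cong₂ _∸_ (m≡m%n+[m/n]*n b d) (m≡m%n+[m/n]*n a d) ⟩
  (b % d + b / d * d) ∸ (a % d + a / d * d) ≡⟨ cong (λ x → (b % d + b / d * d) ∸ (x + a / d * d)) eq ⟩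
  (b % d + b / d * d) ∸ (b % d + a / d * d) ≡⟨ [m+n]∸[m+o]≡n∸o (b % d) _ _ ⟩
  b / d * d ∸ a / d * d                     ≡⟨ *-distribʳ-∸ d (b / d) (a / d) ⟨
  (b / d ∸ a / d) * d                       ∎)

module _ (m : ℕ) .{{_ : NonZero m}} where

  %-absorbˡ-+ : ∀ a b → (a % m + b) % m ≡ (a + b) % m
  %-absorbˡ-+ a b = begin
    (a % m + b) % m          ≡⟨ %-distribˡ-+ (a % m) b m ⟩
    (a % m % m + b % m) % m  ≡⟨ cong (λ x → (x + b % m) % m) (m%n%n≡m%n a m) ⟩
    (a % m + b % m) % m      ≡⟨ %-distribˡ-+ a b m ⟨
    (a + b) % m              ∎

  %-absorbʳ-+ : ∀ a b → (a + b % m) % m ≡ (a + b) % m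
  %-absorbʳ-+ a b = begin
    (a + b % m) % m  ≡⟨ cong (_% m) (+-comm a (b % m)) ⟩
    (b % m + a) % m  ≡⟨ %-absorbˡ-+ b a ⟩
    (b + a) % m      ≡⟨ cong (_% m) (+-comm b a) ⟩
    (a + b) % m      ∎

  %-congˡ-+ : ∀ {a b} c → a % m ≡ b % m → (a + c) % m ≡ (b + c) % m
  %-congˡ-+ {a} {b} c eq = begin
    (a + c) % m      ≡⟨ %-absorbˡ-+ a c ⟨
    (a % m + c) % m  ≡⟨ cong (λ x → (x + c) % m) eq ⟩
    (b % m + c) % m  ≡⟨ %-absorbˡ-+ b c ⟩
    (b + c) % m      ∎

  -- Adding c * m ∸ c, a non-negative representative of −c, undoes adding c.
  %-cancelʳ-+ : ∀ a b c → (a + c) % m ≡ (b + c) % m → a % m ≡ b % m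
  %-cancelʳ-+ a b c eq = begin
    a % m                        ≡⟨ [m+kn]%n≡m%n a c m ⟨
    (a + c * m) % m              ≡⟨ cong (_% m) (shift a) ⟩
    (a + c + (c * m ∸ c)) % m    ≡⟨ %-congˡ-+ (c * m ∸ c) eq ⟩
    (b + c + (c * m ∸ c)) % m    ≡⟨ cong (_% m) (shift b) ⟨
    (b + c * m) % m              ≡⟨ [m+kn]%n≡m%n b c m ⟩
    b % m                        ∎
    where
    shift : ∀ x → x + c * m ≡ x + c + (c * m ∸ c)
    shift x = trans (cong (x +_) (sym (m+[n∸m]≡n (m≤m*n c m)))) (sym (+-assoc x c _))

  %≡0⇒≡m : ∀ {a} → 0 < a → a < m + m → a % m ≡ 0 → a ≡ m
  %≡0⇒≡m {a} 0<a a<2m a%m≡0 with m%n≡0⇒n∣m a m a%m≡0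
  ... | divides zero          refl = contradiction 0<a (<-irrefl refl)
  ... | divides (suc zero)    refl = +-identityʳ m
  ... | divides (suc (suc c)) refl = contradiction a<2m (≤⇒≯ (+-monoʳ-≤ m (m≤m+n m (c * m))))

  %≡%⇒≡ : ∀ {k k′} → k < m → k′ < m → k % m ≡ k′ % m → k ≡ k′
  %≡%⇒≡ k<m k′<m eq = trans (sym (m<n⇒m%n≡m k<m)) (trans eq (m<n⇒m%n≡m k′<m))

  toℕ-mod : ∀ n → toℕ (n mod m) ≡ n % m
  toℕ-mod n = toℕ-fromℕ< (m%n<n n m)

  toℕ-%-injective : ∀ {x y : Fin m} → toℕ x % m ≡ toℕ y % m → x ≡ y
  toℕ-%-injective {x} {y} eq =
    toℕ-injective (trans (sym (m<n⇒m%n≡m (toℕ<n x))) (trans eq (m<n⇒m%n≡m (toℕ<n y))))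

  addₘ-mod : ∀ a b → addₘ m (a mod m) (b mod m) ≡ (a + b) mod m
  addₘ-mod a b = toℕ-%-injective (cong (_% m) (begin
    toℕ (addₘ m (a mod m) (b mod m))  ≡⟨ toℕ-mod _ ⟩
    (toℕ (a mod m) + toℕ (b mod m)) % m ≡⟨ cong₂ (λ x y → (x + y) % m) (toℕ-mod a) (toℕ-mod b) ⟩
    (a % m + b % m) % m ≡⟨ %-distribˡ-+ a b m ⟨
    (a + b) % m ≡⟨ toℕ-mod (a + b) ⟨
    toℕ ((a + b) mod m) ∎))

  addₘ-identityʳ : ∀ x → addₘ m x (zeroₘ m) ≡ x
  addₘ-identityʳ x = toℕ-%-injective (cong (_% m) (begin
    toℕ (addₘ m x (zeroₘ m))        ≡⟨ toℕ-mod _ ⟩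
    (toℕ x + toℕ (0 mod m)) % m     ≡⟨ cong (λ z → (toℕ x + z) % m) (toℕ-mod 0) ⟩
    (toℕ x + 0 % m) % m             ≡⟨ %-absorbʳ-+ (toℕ x) 0 ⟩
    (toℕ x + 0) % m                 ≡⟨ cong (_% m) (+-identityʳ (toℕ x)) ⟩
    toℕ x % m                       ≡⟨ m<n⇒m%n≡m (toℕ<n x) ⟩
    toℕ x                           ∎))

  negₘ-inverseˡ : ∀ x → (toℕ (negₘ m x) + toℕ x) % m ≡ 0
  negₘ-inverseˡ x = begin
    (toℕ (negₘ m x) + toℕ x) % m    ≡⟨ cong (λ z → (z + toℕ x) % m) (toℕ-mod (m ∸ toℕ x)) ⟩
    ((m ∸ toℕ x) % m + toℕ x) % m   ≡⟨ %-absorbˡ-+ (m ∸ toℕ x) (toℕ x) ⟩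
    (m ∸ toℕ x + toℕ x) % m         ≡⟨ cong (_% m) (m∸n+n≡m (<⇒≤ (toℕ<n x))) ⟩
    m % m                           ≡⟨ n%n≡0 m ⟩
    0                               ∎

  negₘ-unique : ∀ x y → (toℕ y + toℕ x) % m ≡ 0 → negₘ m x ≡ y
  negₘ-unique x y y+x≡0 =
    toℕ-%-injective (%-cancelʳ-+ _ _ (toℕ x) (trans (negₘ-inverseˡ x) (sym y+x≡0)))

  negₘ-involutive : ∀ x → negₘ m (negₘ m x) ≡ x
  negₘ-involutive x =
    negₘ-unique (negₘ m x) x (trans (cong (_% m) (+-comm (toℕ x) _)) (negₘ-inverseˡ x))

  negₘ-injective : ∀ {x y} → negₘ m x ≡ negₘ m y → x ≡ y
  negₘ-injective {x} {y} eq =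
    trans (sym (negₘ-involutive x)) (trans (cong (negₘ m) eq) (negₘ-involutive y))

  negₘ-zero : negₘ m (zeroₘ m) ≡ m mod m
  negₘ-zero = negₘ-unique (zeroₘ m) (m mod m) (begin
    (toℕ (m mod m) + toℕ (0 mod m)) % m  ≡⟨ cong₂ (λ x y → (x + y) % m) (toℕ-mod m) (toℕ-mod 0) ⟩
    (m % m + 0 % m) % m                  ≡⟨ %-distribˡ-+ m 0 m ⟨
    (m + 0) % m                          ≡⟨ cong (_% m) (+-identityʳ m) ⟩
    m % m                                ≡⟨ n%n≡0 m ⟩
    0                                    ∎)

  -- The orbit 0, 1, -1, 2, -2, ... of 0 under alternately applying x ↦ 1 - x and
  -- x ↦ -x: after 2n + 1 steps it is at n + 1, after 2n steps at -n.
  zigzag : ℕ → Bool → Fin m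
  zigzag n false = negₘ m (n mod m)
  zigzag n true  = suc n mod m

  zigzag-flip : ∀ n b → addₘ m (negₘ m (zigzag n b)) (oneₘ m) ≡ zigzag n (not b)
  zigzag-flip n false = begin
    addₘ m (negₘ m (negₘ m (n mod m))) (1 mod m) ≡⟨ cong (λ x → addₘ m x (1 mod m)) (negₘ-involutive (n mod m)) ⟩
    addₘ m (n mod m) (1 mod m)                   ≡⟨ addₘ-mod n 1 ⟩
    (n + 1) mod m                                ≡⟨ cong (_mod m) (+-comm n 1) ⟩
    suc n mod m                                  ∎
  zigzag-flip n true = sym (negₘ-unique (n mod m) _ (begin
    (toℕ (addₘ m u (1 mod m)) + toℕ (n mod m)) % m ≡⟨ cong₂ (λ x y → (x + y) % m) (toℕ-mod _) (toℕ-mod n) ⟩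
    ((toℕ u + toℕ (1 mod m)) % m + n % m) % m      ≡⟨ %-absorbˡ-+ _ _ ⟩
    (toℕ u + toℕ (1 mod m) + n % m) % m            ≡⟨ cong (λ x → (toℕ u + x + n % m) % m) (toℕ-mod 1) ⟩
    (toℕ u + 1 % m + n % m) % m                    ≡⟨ cong (_% m) (+-assoc (toℕ u) _ _) ⟩
    (toℕ u + (1 % m + n % m)) % m                  ≡⟨ %-absorbʳ-+ (toℕ u) _ ⟨
    (toℕ u + (1 % m + n % m) % m) % m              ≡⟨ cong (λ x → (toℕ u + x) % m) (%-distribˡ-+ 1 n m) ⟨
    (toℕ u + suc n % m) % m                        ≡⟨ cong (λ x → (toℕ u + x) % m) (toℕ-mod (suc n)) ⟨
    (toℕ u + toℕ (suc n mod m)) % m                ≡⟨ negₘ-inverseˡ (suc n mod m) ⟩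
    0                                              ∎))
    where u = negₘ m (suc n mod m)

  zigzag-cancel : ∀ {n n′} b → zigzag n b ≡ zigzag n′ b → n % m ≡ n′ % m
  zigzag-cancel {n} {n′} false eq =
    trans (sym (toℕ-mod n)) (trans (cong toℕ (negₘ-injective eq)) (toℕ-mod n′))
  zigzag-cancel {n} {n′} true eq = %-cancelʳ-+ n n′ 1 (begin
    (n + 1) % m       ≡⟨ cong (_% m) (+-comm n 1) ⟩
    suc n % m         ≡⟨ toℕ-mod (suc n) ⟨
    toℕ (suc n mod m) ≡⟨ cong toℕ eq ⟩
    toℕ (suc n′ mod m) ≡⟨ toℕ-mod (suc n′) ⟩
    suc n′ % m        ≡⟨ cong (_% m) (+-comm 1 n′) ⟩
    (n′ + 1) % m      ∎)

  zigzag-opposite : ∀ {n n′} → zigzag n false ≡ zigzag n′ true → (n + suc n′) % m ≡ 0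
  zigzag-opposite {n} {n′} eq = begin
    (n + suc n′) % m                              ≡⟨ cong (_% m) (+-comm n (suc n′)) ⟩
    (suc n′ + n) % m                              ≡⟨ %-distribˡ-+ (suc n′) n m ⟩
    (suc n′ % m + n % m) % m                      ≡⟨ cong₂ (λ x y → (x + y) % m) (toℕ-mod (suc n′)) (toℕ-mod n) ⟨
    (toℕ (suc n′ mod m) + toℕ (n mod m)) % m      ≡⟨ cong (λ x → (toℕ x + toℕ (n mod m)) % m) eq ⟨
    (toℕ (negₘ m (n mod m)) + toℕ (n mod m)) % m  ≡⟨ negₘ-inverseˡ (n mod m) ⟩
    0                                             ∎

  zigzag-opposite-even : ∀ {k k′} → k < m → k′ < m →
    zigzag k false ≡ zigzag k′ true → odd k ≡ not (odd k′) → odd m ≡ false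
  zigzag-opposite-even {k} {k′} k<m k′<m eq h = begin
    odd m                  ≡⟨ cong odd k+1+k′≡m ⟨
    odd (k + suc k′)       ≡⟨ odd-+ k (suc k′) ⟩
    odd k xor not (odd k′) ≡⟨ cong (_xor not (odd k′)) h ⟩
    not (odd k′) xor not (odd k′) ≡⟨ xor-same (not (odd k′)) ⟩
    false                  ∎
    where
    k+1+k′≡m : k + suc k′ ≡ m
    k+1+k′≡m = %≡0⇒≡m (≤-trans (s≤s z≤n) (m≤n+m (suc k′) k)) (+-mono-<-≤ k<m k′<m) (zigzag-opposite eq)

  zigzag-injective : odd m ≡ true → ∀ {k k′} e e′ → k < m → k′ < m →
    zigzag k e ≡ zigzag k′ e′ → e xor odd k ≡ e′ xor odd k′ → k ≡ k′ × e ≡ e′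
  zigzag-injective _ false false k<m k′<m eq _ = %≡%⇒≡ k<m k′<m (zigzag-cancel false eq) , refl
  zigzag-injective _ true  true  k<m k′<m eq _ = %≡%⇒≡ k<m k′<m (zigzag-cancel true eq) , refl
  zigzag-injective m-odd false true k<m k′<m eq h =
    contradiction (trans (sym m-odd) (zigzag-opposite-even k<m k′<m eq h)) λ ()
  zigzag-injective m-odd true false k<m k′<m eq h =
    contradiction (trans (sym m-odd) (zigzag-opposite-even k′<m k<m (sym eq) (sym h))) λ ()

module _ (q : ℕ) .{{_ : NonZero q}} (q-odd : odd q ≡ true) where

  private
    shift-free : ∀ r c → c * q < 4 * q → odd r ≡ odd (r + c * q) →
      odd ⌊ r /2⌋ ≡ odd ⌊ r + c * q /2⌋ → c ≡ 0
    shift-free r 0 _ _ _ = refl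
    shift-free r 1 _ e _ = contradiction (trans e (odd-+-odd r (trans (odd-* 1 q) q-odd))) (not-¬ refl)
    shift-free r 2 _ _ e =
      contradiction (trans e (trans (cong odd (⌊m+2n/2⌋≡⌊m/2⌋+n r q)) (odd-+-odd ⌊ r /2⌋ q-odd))) (not-¬ refl)
    shift-free r 3 _ e _ = contradiction (trans e (odd-+-odd r (trans (odd-* 3 q) q-odd))) (not-¬ refl)
    shift-free r (suc (suc (suc (suc c)))) cq<4q _ _ =
      contradiction (*-cancelʳ-< q (4 + c) 4 cq<4q) λ { (s≤s (s≤s (s≤s (s≤s ())))) }

    residue-injective-≤ : ∀ {r r′} → r ≤ r′ → r′ < 4 * q → r % q ≡ r′ % q → odd r ≡ odd r′ →
      odd ⌊ r /2⌋ ≡ odd ⌊ r′ /2⌋ → r ≡ r′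
    residue-injective-≤ {r} {r′} r≤r′ r′<4q ≡q ≡₂ ≡⌊/2⌋ with %≡%⇒∣∸ q ≡q
    ... | divides c r′∸r≡cq = sym (begin
      r′         ≡⟨ r′≡r+cq ⟩
      r + c * q  ≡⟨ cong (λ x → r + x * q) c≡0 ⟩
      r + 0      ≡⟨ +-identityʳ r ⟩
      r          ∎)
      where
      r′≡r+cq : r′ ≡ r + c * q
      r′≡r+cq = trans (sym (m+[n∸m]≡n r≤r′)) (cong (r +_) r′∸r≡cq)
      c≡0 : c ≡ 0
      c≡0 = shift-free r c (subst (_< 4 * q) r′∸r≡cq (≤-<-trans (m∸n≤m r′ r) r′<4q))
        (trans ≡₂ (cong odd r′≡r+cq)) (trans ≡⌊/2⌋ (cong (λ x → odd ⌊ x /2⌋) r′≡r+cq))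

  residue-injective : ∀ {r r′} → r < 4 * q → r′ < 4 * q → r % q ≡ r′ % q → odd r ≡ odd r′ →
    odd ⌊ r /2⌋ ≡ odd ⌊ r′ /2⌋ → r ≡ r′
  residue-injective {r} {r′} r<4q r′<4q ≡q ≡₂ ≡⌊/2⌋ with ≤-total r r′
  ... | inj₁ r≤r′ = residue-injective-≤ r≤r′ r′<4q ≡q ≡₂ ≡⌊/2⌋
  ... | inj₂ r′≤r = sym (residue-injective-≤ r′≤r r<4q (sym ≡q) (sym ≡₂) (sym ≡⌊/2⌋))

-- Hamiltonian cycles from closed walks

InjectiveBelow : {V : Set} → ℕ → (ℕ → V) → Set
InjectiveBelow N f = ∀ {i j} → i < N → j < N → f i ≡ f j → i ≡ j

module _ {V : Set} {M : ℕ} (enc : V ↣ Fin M) where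

  open Injection enc using (to; injective)

  injectiveBelow⇒surjectiveBelow : ∀ {N} (f : ℕ → V) → M ≤ N → InjectiveBelow N f →
    ∀ v → ∃[ n ] (n < N × f n ≡ v)
  injectiveBelow⇒surjectiveBelow {N} f M≤N f-inj v with any? (λ (i : Fin N) → to (f (toℕ i)) ≟ᶠ to v)
  ... | yes (i , fi≡v) = toℕ i , toℕ<n i , injective fi≡v
  ... | no  v∉f        = contradiction (injective⇒≤ g-injective) (≤⇒≯ M≤N)
    where
    g : Fin (suc N) → Fin M
    g zero    = to v
    g (suc i) = to (f (toℕ i))
    g-injective : ∀ {i j} → g i ≡ g j → i ≡ j
    g-injective {zero}  {zero}  _  = refl
    g-injective {zero}  {suc j} eq = contradiction (j , sym eq) v∉f
    g-injective {suc i} {zero}  eq = contradiction (i , eq) v∉f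
    g-injective {suc i} {suc j} eq =
      cong suc (toℕ-injective (f-inj (toℕ<n i) (toℕ<n j) (injective eq)))

  closedWalk⇒hamiltonianCycle : ∀ {Adj : V → V → Set} N (f : ℕ → V) → M ≤ N → 3 ≤ N →
    (∀ n → Adj (f n) (f (suc n))) → f N ≡ f 0 → InjectiveBelow N f → HamiltonianCycle Adj
  closedWalk⇒hamiltonianCycle {Adj} (suc K) f M≤N 3≤N adj closed f-inj = record
    { start    = f 0
    ; rest     = applyUpTo (f ∘ suc) K
    ; distinct = Unique.applyUpTo⁺₁ f (suc K) λ i<j j<N → <⇒≢ i<j ∘ f-inj (<-trans i<j j<N) j<N
    ; covers   = λ v → let n , n<N , fn≡v = injectiveBelow⇒surjectiveBelow f M≤N f-inj v
                       in Any.applyUpTo⁺ f (sym fn≡v) n<N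
    ; long     = subst (3 ≤_) (sym (length-applyUpTo f (suc K))) 3≤N
    ; adjacent = subst (Linked Adj) walk≡cycle (Linked.applyUpTo⁺₂ f (suc (suc K)) adj)
    }
    where
    walk≡cycle : applyUpTo f (suc (suc K)) ≡ f 0 ∷ (applyUpTo (f ∘ suc) K ∷ʳ f 0)
    walk≡cycle = cong (f 0 ∷_) (trans (sym (applyUpTo-∷ʳ (f ∘ suc) K)) (cong (applyUpTo (f ∘ suc) K ∷ʳ_) closed))

-- The cycle in (ℤ₂)³ ⋉ ℤ_pq

Elt↔ : ∀ {p q} → Elt p q ↔ (Bool × Bool × Bool × Fin p × Fin q)
Elt↔ = mk↔ₛ′ (λ (elt α β γ i j) → α , β , γ , i , j) (λ (α , β , γ , i , j) → elt α β γ i j)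
  (λ _ → refl) (λ _ → refl)

Elt↣Fin : ∀ p q → Elt p q ↣ Fin (2 * (2 * (2 * (p * q))))
Elt↣Fin p q = ↔⇒↣ (↔-trans Elt↔ (↔-sym Fin↔))
  where
  Fin↔ : Fin (2 * (2 * (2 * (p * q)))) ↔ (Bool × Bool × Bool × Fin p × Fin q)
  Fin↔ = ↔-trans *↔× (2↔Bool ×-↔ ↔-trans *↔× (2↔Bool ×-↔ ↔-trans *↔× (2↔Bool ×-↔ *↔×)))

elt-cong : ∀ {p q α β γ i j α′ β′ γ′ i′ j′} → α ≡ α′ → β ≡ β′ → γ ≡ γ′ → i ≡ i′ → j ≡ j′ →
  elt {p} {q} α β γ i j ≡ elt α′ β′ γ′ i′ j′
elt-cong refl refl refl refl refl = refl

xor-cancelˡ : ∀ x {y z} → x xor y ≡ x xor z → y ≡ z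
xor-cancelˡ false eq = eq
xor-cancelˡ true  eq = not-injective eq

2*[1+m+n]≡2+2*[m+n] : ∀ m n → 2 * (suc m + n) ≡ suc (suc (2 * (m + n)))
2*[1+m+n]≡2+2*[m+n] = solve-∀

module Walk (p′ q′ : ℕ) (p-odd : odd (suc p′) ≡ true) (q-odd : odd (suc q′) ≡ true) where

  p q : ℕ
  p = suc p′
  q = suc q′

  infixl 7 _∙_
  _∙_ : Elt p q → Elt p q → Elt p q
  _∙_ = _·_ p q

  -- (r , k , e) is the vertex reached after r complete rows, then k copies of s₄ a,
  -- then one more s₄ if e.  The first r rows contribute r, r + ⌈r/2⌉ ≡ ⌊r/2⌋ and
  -- ⌊r/2⌋ to the exponents of a, b and c modulo 2, as rows alternately end in b and c.
  State : Set
  State = ℕ × ℕ × Bool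

  vertex : State → Elt p q
  vertex (r , k , e) =
    elt (e xor odd r) (odd ⌊ r /2⌋ xor (e xor odd k)) (odd ⌊ r /2⌋) (zigzag p k e) (zigzag q r (e xor odd k))

  rowEnd : Bool → Elt p q
  rowEnd x = elt false (not x) x (zeroₘ p) (zeroₘ q)

  step : State → State
  step (r , k , false) = r , k , true
  step (r , k , true) with suc k ≟ p
  ... | yes _ = suc r , 0 , false
  ... | no  _ = r , suc k , false

  generator : State → Elt p q
  generator (r , k , false) = s₄ p q
  generator (r , k , true) with suc k ≟ p
  ... | yes _ = rowEnd (odd r)
  ... | no  _ = a p q

  generator∈S : ∀ s → generator s ∈ S p q
  generator∈S (r , k , false) = there (there (there (here refl)))
  generator∈S (r , k , true) with suc k ≟ p
  ... | yes _ = rowEnd∈S (odd r)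
    where
    rowEnd∈S : ∀ x → rowEnd x ∈ S p q
    rowEnd∈S false = there (here refl)
    rowEnd∈S true  = there (there (here refl))
  ... | no  _ = here refl

  step-rowEnd : ∀ r k → suc k ≡ p → step (r , k , true) ≡ (suc r , 0 , false)
  step-rowEnd r k 1+k≡p with suc k ≟ p
  ... | yes _      = refl
  ... | no 1+k≢p   = contradiction 1+k≡p 1+k≢p

  step-inner : ∀ r k → suc k < p → step (r , k , true) ≡ (r , suc k , false)
  step-inner r k 1+k<p with suc k ≟ p
  ... | yes 1+k≡p  = contradiction 1+k≡p (<⇒≢ 1+k<p)
  ... | no _       = refl

  vertex-rowEnd : ∀ r k → suc k ≡ p → vertex (suc r , 0 , false) ≡ vertex (r , k , true) ∙ rowEnd (odd r)
  vertex-rowEnd r k 1+k≡p rewrite xor-inverseˡ (odd r) | trans (cong odd 1+k≡p) p-odd = elt-cong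
    (sym (xor-identityʳ _))
    (begin
      odd ⌊ suc r /2⌋ xor false  ≡⟨ xor-identityʳ _ ⟩
      odd ⌊ suc r /2⌋            ≡⟨ ⌊1+r/2⌋ ⟩
      y xor x                    ≡⟨ xor-annihilates-not y x ⟨
      not y xor not x            ≡⟨ cong (_xor not x) (xor-comm y true) ⟨
      (y xor true) xor not x     ∎)
    ⌊1+r/2⌋
    (trans (negₘ-zero p) (trans (cong (_mod p) (sym 1+k≡p)) (sym (addₘ-identityʳ p _))))
    (sym (addₘ-identityʳ q _))
    where
    x = odd r
    y = odd ⌊ r /2⌋
    ⌊1+r/2⌋ : odd ⌊ suc r /2⌋ ≡ y xor x
    ⌊1+r/2⌋ = trans (odd-⌊1+n/2⌋ r) (xor-comm x y)

  vertex-step : ∀ s → vertex (step s) ≡ vertex s ∙ generator s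
  vertex-step (r , k , false) = elt-cong
    (sym (xor-comm (odd r) true))
    (trans (sym (not-distribʳ-xor (odd ⌊ r /2⌋) (odd k))) (sym (xor-comm _ true)))
    (sym (xor-identityʳ _))
    (sym (zigzag-flip p k false))
    (sym (zigzag-flip q r (odd k)))
  vertex-step (r , k , true) with suc k ≟ p
  ... | yes 1+k≡p = vertex-rowEnd r k 1+k≡p
  ... | no  _     = elt-cong
    (trans (sym (not-involutive (odd r))) (sym (xor-comm (not (odd r)) true)))
    (sym (xor-identityʳ _))
    (sym (xor-identityʳ _))
    (sym (addₘ-identityʳ p _))
    (sym (addₘ-identityʳ q _))

  Valid : State → Set
  Valid (_ , k , _) = k < p

  index : State → ℕ
  index (r , k , false) = 2 * (k + r * p)
  index (r , k , true)  = suc (2 * (k + r * p))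

  index-step : ∀ s → Valid s → index (step s) ≡ suc (index s) × Valid (step s)
  index-step (r , k , false) k<p = refl , k<p
  index-step (r , k , true)  k<p with suc k ≟ p
  ... | yes refl    = 2*[1+m+n]≡2+2*[m+n] p′ (r * p) , s≤s z≤n
  ... | no  1+k≢p  = 2*[1+m+n]≡2+2*[m+n] k (r * p) , ≤∧≢⇒< k<p 1+k≢p

  state : ℕ → State
  state zero    = 0 , 0 , false
  state (suc n) = step (state n)

  index-state : ∀ n → index (state n) ≡ n × Valid (state n)
  index-state zero = refl , s≤s z≤n
  index-state (suc n) =
    let i≡n , valid = index-state n
        i′≡1+i , valid′ = index-step (state n) valid
    in trans i′≡1+i (cong suc i≡n) , valid′

  state-index : ∀ r k → k < p → state (index (r , k , false)) ≡ (r , k , false)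
  state-index zero    zero    _     = refl
  state-index (suc r) zero    _     = begin
    state (2 * (suc p′ + r * p))            ≡⟨ cong state (2*[1+m+n]≡2+2*[m+n] p′ (r * p)) ⟩
    step (step (state (2 * (p′ + r * p))))  ≡⟨ cong (λ s → step (step s)) (state-index r p′ ≤-refl) ⟩
    step (r , p′ , true)                    ≡⟨ step-rowEnd r p′ refl ⟩
    (suc r , 0 , false)                     ∎
  state-index r       (suc k) 1+k<p = begin
    state (2 * (suc k + r * p))             ≡⟨ cong state (2*[1+m+n]≡2+2*[m+n] k (r * p)) ⟩
    step (step (state (2 * (k + r * p))))   ≡⟨ cong (λ s → step (step s)) (state-index r k (<-trans (n<1+n k) 1+k<p)) ⟩
    step (r , k , true)                     ≡⟨ step-inner r k 1+k<p ⟩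
    (r , suc k , false)                     ∎

  rows : ℕ
  rows = 4 * q

  cycleLength : ℕ
  cycleLength = index (rows , 0 , false)

  walk : ℕ → Elt p q
  walk n = vertex (state n)

  walk-adjacent : ∀ n → CayAdj _∙_ (S p q) (walk n) (walk (suc n))
  walk-adjacent n = generator (state n) , generator∈S (state n) , inj₁ (vertex-step (state n))

  walk-closed : walk cycleLength ≡ walk 0
  walk-closed rewrite state-index rows 0 (s≤s z≤n) =
    elt-cong rows-even (cong (_xor false) half-rows-even) half-rows-even refl (cong (negₘ q) rows≡0)
    where
    rows≡2*2q : rows ≡ 2 * (2 * q)
    rows≡2*2q = *-assoc 2 2 q
    rows-even : odd rows ≡ false
    rows-even = trans (cong odd rows≡2*2q) (odd-2* (2 * q))
    half-rows-even : odd ⌊ rows /2⌋ ≡ false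
    half-rows-even = trans (cong (λ n → odd ⌊ n /2⌋) rows≡2*2q)
      (trans (cong odd (⌊m+2n/2⌋≡⌊m/2⌋+n 0 (2 * q))) (odd-2* q))
    rows≡0 : rows mod q ≡ 0 mod q
    rows≡0 = toℕ-injective (trans (toℕ-mod q rows) (m*n%n≡0 4 q))

  row : State → ℕ
  row (r , _ , _) = r

  row<rows : ∀ s → index s < cycleLength → row s < rows
  row<rows (r , k , e) i<N = *-cancelʳ-< p r rows (*-cancelˡ-< 2 _ _ (≤-<-trans (rowStart≤index e) i<N))
    where
    rowStart≤index : ∀ e → 2 * (r * p) ≤ index (r , k , e)
    rowStart≤index false = *-monoʳ-≤ 2 (m≤n+m (r * p) k)
    rowStart≤index true  = m≤n⇒m≤1+n (rowStart≤index false)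

  vertex-injective : ∀ s s′ → row s < rows → row s′ < rows → Valid s → Valid s′ → vertex s ≡ vertex s′ → s ≡ s′
  vertex-injective (r , k , e) (r′ , k′ , e′) r<rows r′<rows k<p k′<p eq
    with zigzag-injective p p-odd e e′ k<p k′<p (cong Elt.i eq)
           (xor-cancelˡ (odd ⌊ r /2⌋) (trans (cong Elt.β eq) (cong (_xor (e′ xor odd k′)) (sym (cong Elt.γ eq)))))
  ... | refl , refl = cong (_, k , e) (residue-injective q q-odd r<rows r′<rows
          (zigzag-cancel q (e xor odd k) (cong Elt.j eq)) (xor-cancelˡ e (cong Elt.α eq)) (cong Elt.γ eq))

  walk-injective : InjectiveBelow cycleLength walk
  walk-injective {i} {j} i<N j<N eq = begin
    i                ≡⟨ proj₁ (index-state i) ⟨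
    index (state i)  ≡⟨ cong index (vertex-injective (state i) (state j) (bound i i<N) (bound j j<N)
                                      (proj₂ (index-state i)) (proj₂ (index-state j)) eq) ⟩
    index (state j)  ≡⟨ proj₁ (index-state j) ⟩
    j                ∎
    where
    bound : ∀ n → n < cycleLength → row (state n) < rows
    bound n n<N = row<rows (state n) (subst (_< cycleLength) (sym (proj₁ (index-state n))) n<N)

  hamiltonianCycle : CayleyHamiltonian p q
  hamiltonianCycle = closedWalk⇒hamiltonianCycle (Elt↣Fin p q) cycleLength walk (≤-reflexive (|G|≡ p q)) 3≤N
    walk-adjacent walk-closed walk-injective
    where
    |G|≡ : ∀ p q → 2 * (2 * (2 * (p * q))) ≡ 2 * (4 * q * p)
    |G|≡ = solve-∀
    3≤N : 3 ≤ cycleLength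
    3≤N = ≤-trans (n≤1+n 3) (≤-trans (m≤m*n 4 q) (≤-trans (m≤m*n (4 * q) p) (m≤n*m _ 2)))

even⇒2∣ : ∀ n → odd n ≡ false → 2 ∣ n
even⇒2∣ zero                _ = divides 0 refl
even⇒2∣ (suc zero)          ()
even⇒2∣ (suc (suc n)) n-even = ∣m∣n⇒∣m+n ∣-refl (even⇒2∣ n (trans (sym (not-involutive (odd n))) n-even))

prime⇒odd : ∀ {n} → Prime n → 2 < n → odd n ≡ true
prime⇒odd {n} n-prime 2<n with odd n in n-parity
... | true  = refl
... | false = contradiction (composite 2<n (even⇒2∣ n n-parity)) (prime⇒¬composite n-prime)

lemma7p6 : (p q : ℕ) .{{_ : NonZero p}} .{{_ : NonZero q}} →
    Prime p → Prime q → p ≢ q → 5 < p → 5 < q →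
    CayleyHamiltonian p q
lemma7p6 (suc p′) (suc q′) p-prime q-prime _ 5<p 5<q =
  Walk.hamiltonianCycle p′ q′ (prime⇒odd p-prime (2< 5<p)) (prime⇒odd q-prime (2< 5<q))
  where
  2< : ∀ {n} → 5 < n → 2 < n
  2< 5<n = ≤-trans (s≤s (s≤s (s≤s z≤n))) (<⇒≤ 5<n)
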